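{- Let $(F_n)_{n\ge 0}$ be the Fibonacci sequence, $F_0=0$, $F_1=1$, $F_{n+1}=F_n+F_{n-1}$. For a positive integer $n$ let $z(n)$ be the least positive integer $m$ such that $n\mid F_m$, and let $z^i$ denote the $i$-fold iterate of $z$. For a positive integer $k$ let \[\mathcal A_k:=\{\,n\in\mathbb N : z(n)\mid n \text{ and } n/z(n)=k\,\}.\] Let $k$ be a positive integer such that $\mathcal A_k\neq\varnothing$, and let $c(k):=\min\mathcal A_k$. Then the sequence of iterates $z(k),z^2(k),z^3(k),\dots$ has a well-defined (finite) least common multiple, and \[ c(k)=k\cdot \operatorname{lcm}\{z^i(k) : i\ge 1\}. \]
   Context: $z(n)$ is the Fibonacci entry point (order of appearance) of $n$; it exists for every positive integer $n$. Note that $n\mid F_n$ if and only if $z(n)\mid n$, so the sets $\mathcal A_k$ partition the set of positive integers $n$ with $n\mid F_n$. -}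

module Defs where

open import Data.Nat using (ℕ; zero; suc; _+_; _*_; _<_; _≤_)
open import Data.Nat.Divisibility using (_∣_)
open import Data.Product using (_×_)
open import Relation.Nullary using (¬_)
open import Relation.Binary.PropositionalEquality using (_≡_)

F : ℕ → ℕ
F zero = 0
F (suc zero) = 1
F (suc (suc n)) = F (suc n) + F n

IsEntryPoint : ℕ → ℕ → Set
IsEntryPoint n m = (0 < m) × (n ∣ F m) × (∀ j → 0 < j → j < m → ¬ (n ∣ F j))

iter : (ℕ → ℕ) → ℕ → ℕ → ℕ
iter f zero x = x
iter f (suc i) x = f (iter f i x)

InA : (ℕ → ℕ) → ℕ → ℕ → Set
InA z k n = (0 < n) × (z n ∣ n) × (n ≡ k * z n)

IsLcmOfSeq : (ℕ → ℕ) → ℕ → Set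
IsLcmOfSeq f L = (∀ i → 1 ≤ i → f i ∣ L) × (∀ M → (∀ i → 1 ≤ i → f i ∣ M) → L ∣ M)

IsMin : (ℕ → Set) → ℕ → Set
IsMin P c = P c × (∀ n → P n → c ≤ n)

{-# OPTIONS --safe #-}
-- For n ∈ A_k we have k ∣ n and z n ∣ n, hence z (z n) ∣ z n, and inductively every iterate z^i k
-- (i ≥ 1) divides z n; so the iterates have an lcm L, with L ∣ z n, i.e. n = k z n ≥ k L.
-- Conversely k L ∈ A_k: as L ∣ F L, it suffices that k L ∣ F L, for then z (k L) ∣ L ∣ z (k L).
-- Writing z n = r L for some n ∈ A_k gives k L r ∣ F (r L), and the primes q of r are removed one
-- at a time: F (q a) / F a shares no prime with F a other than q, and contains q exactly once when
-- q ∣ F a (for q = 2 this needs 2 ∣ a, which is why an even k uses 4 ∣ z (z k) ∣ L).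
module Submission where

open import Defs
open import Data.Nat
open import Data.Nat.Properties
open import Data.Nat.Divisibility
open import Data.Nat.DivMod using (_/_; _%_; m≡m%n+[m/n]*n; m%n<n)
open import Data.Nat.Coprimality using (Coprime; coprime-divisor)
open import Data.Nat.LCM using (lcm; m∣lcm[m,n]; n∣lcm[m,n]; lcm-least)
open import Data.Nat.Primality
open import Data.Nat.Primality.Factorisation using (factorise)
open import Data.Nat.ListAction using (product)
open import Data.Nat.Tactic.RingSolver using (solve-∀)
open import Data.List using ([]; _∷_)
open import Data.List.Relation.Unary.All using (All; []; _∷_)
open import Data.Product
open import Data.Sum
open import Relation.Nullary
open import Relation.Binary.PropositionalEquality

0<F[1+n] : ∀ n → 0 < F (suc n)
0<F[1+n] zero = s≤s z≤n
0<F[1+n] (suc n) = ≤-trans (0<F[1+n] n) (m≤m+n (F (suc n)) (F n))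

F[m+1+n] : ∀ m n → F (m + suc n) ≡ F (suc m) * F (suc n) + F m * F n
F[m+1+n] zero n = sym (trans (+-identityʳ _) (+-identityʳ _))
F[m+1+n] (suc m) n = begin
  F (suc m + suc n)                                ≡⟨ cong F (sym (+-suc m (suc n))) ⟩
  F (m + suc (suc n))                              ≡⟨ F[m+1+n] m (suc n) ⟩
  F (suc m) * (F (suc n) + F n) + F m * F (suc n)  ≡⟨ regroup (F (suc m)) (F m) (F (suc n)) (F n) ⟩
  (F (suc m) + F m) * F (suc n) + F (suc m) * F n  ∎
  where
  open ≡-Reasoning
  regroup : ∀ a b c d → a * (c + d) + b * c ≡ (a + b) * c + a * d
  regroup = solve-∀

∣F[n]∧∣F[1+n]⇒∣1 : ∀ n {d} → d ∣ F n → d ∣ F (suc n) → d ∣ 1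
∣F[n]∧∣F[1+n]⇒∣1 zero d∣F₀ d∣F₁ = d∣F₁
∣F[n]∧∣F[1+n]⇒∣1 (suc n) d∣F₁₊ₙ d∣F₂₊ₙ = ∣F[n]∧∣F[1+n]⇒∣1 n (∣m+n∣m⇒∣n d∣F₂₊ₙ d∣F₁₊ₙ) d∣F₁₊ₙ

F[a]∣F[j*a] : ∀ a j → F a ∣ F (j * a)
F[a]∣F[j*a] a zero = F a ∣0
F[a]∣F[j*a] zero (suc j) = subst (λ t → F 0 ∣ F t) (sym (*-zeroʳ j)) ∣-refl
F[a]∣F[j*a] (suc c) (suc j) = subst (F (suc c) ∣_) (sym F[a+j*a])
  (∣m∣n⇒∣m+n (∣n⇒∣m*n (F (suc (j * suc c))) ∣-refl) (∣m⇒∣m*n (F c) (F[a]∣F[j*a] (suc c) j)))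
  where
  F[a+j*a] : F (suc j * suc c) ≡ F (suc (j * suc c)) * F (suc c) + F (j * suc c) * F c
  F[a+j*a] = trans (cong F (+-comm (suc c) (j * suc c))) (F[m+1+n] (j * suc c) c)

F-mono-∣ : ∀ {a b} → a ∣ b → F a ∣ F b
F-mono-∣ {a} (divides j refl) = F[a]∣F[j*a] a j

∣F[m+n]∧∣F[n]⇒∣F[m] : ∀ {d} m n → d ∣ F (m + n) → d ∣ F n → d ∣ F m
∣F[m+n]∧∣F[n]⇒∣F[m] m zero d∣F[m+0] _ = subst (λ t → _ ∣ F t) (+-identityʳ m) d∣F[m+0]
∣F[m+n]∧∣F[n]⇒∣F[m] {d} m (suc n) d∣F[m+1+n] d∣F[1+n] = coprime-divisor coprime d∣Fn*Fm
  where
  coprime : Coprime d (F n)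
  coprime (e∣d , e∣Fn) = ∣1⇒≡1 (∣F[n]∧∣F[1+n]⇒∣1 n e∣Fn (∣-trans e∣d d∣F[1+n]))
  d∣Fn*Fm : d ∣ F n * F m
  d∣Fn*Fm = subst (d ∣_) (*-comm (F m) (F n))
    (∣m+n∣m⇒∣n (subst (d ∣_) (F[m+1+n] m n) d∣F[m+1+n]) (∣n⇒∣m*n (F (suc m)) d∣F[1+n]))

entryPoint∣ : ∀ {n e m} → IsEntryPoint n e → n ∣ F m → e ∣ m
entryPoint∣ {n} {e} {m} (0<e , n∣Fe , minimal) n∣Fm = m%n≡0⇒n∣m m e m%e≡0
  where
  instance
    e≢0 : NonZero e
    e≢0 = >-nonZero 0<e
  n∣F[m%e] : n ∣ F (m % e)
  n∣F[m%e] = ∣F[m+n]∧∣F[n]⇒∣F[m] (m % e) (m / e * e)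
    (subst (λ t → n ∣ F t) (m≡m%n+[m/n]*n m e) n∣Fm) (∣-trans n∣Fe (F-mono-∣ (n∣m*n (m / e))))
  m%e≡0 : m % e ≡ 0
  m%e≡0 = n≤0⇒n≡0 (≮⇒≥ λ 0<m%e → minimal (m % e) 0<m%e (m%n<n m e) n∣F[m%e])

infix 4 _≡_[mod⁺_]
_≡_[mod⁺_] : ℕ → ℕ → ℕ → Set
a ≡ b [mod⁺ m ] = ∃[ t ] a ≡ b + t * m

twiceChoose2 : ℕ → ℕ
twiceChoose2 zero = 0
twiceChoose2 (suc r) = twiceChoose2 r + 2 * r

q∣twiceChoose2[q] : ∀ q → q ∣ twiceChoose2 q
q∣twiceChoose2[q] q = subst (q ∣_) (sym (closedForm q)) (n∣m*n (pred q))
  where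
  closedForm : ∀ q → twiceChoose2 q ≡ pred q * q
  closedForm zero = refl
  closedForm (suc zero) = refl
  closedForm (suc (suc r)) = trans (cong (_+ 2 * suc r) (closedForm (suc r))) (step r)
    where
    step : ∀ r → r * suc r + 2 * suc r ≡ suc r * suc (suc r)
    step = solve-∀

F[2*a] : ∀ c → F (2 * suc c) ≡ (F (suc c) + 2 * F c) * F (suc c)
F[2*a] c = begin
  F (2 * suc c)                                          ≡⟨ cong F (cong (suc c +_) (+-identityʳ (suc c))) ⟩
  F (suc c + suc c)                                      ≡⟨ F[m+1+n] (suc c) c ⟩
  (F (suc c) + F c) * F (suc c) + F (suc c) * F c        ≡⟨ regroup (F (suc c)) (F c) ⟩
  (F (suc c) + 2 * F c) * F (suc c)                      ∎
  where
  open ≡-Reasoning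
  regroup : ∀ x y → (x + y) * x + x * y ≡ (x + 2 * y) * x
  regroup = solve-∀

module _ (c : ℕ) where
  private
    a x y : ℕ
    a = suc c
    x = F a
    y = F c
    G : ℕ → ℕ
    G r = F (r * a)
    H : ℕ → ℕ
    H r = F (suc (r * a))

    G-suc : ∀ r → G (suc r) ≡ H r * x + G r * y
    G-suc r = trans (cong F (+-comm a (r * a))) (F[m+1+n] (r * a) c)

    H-suc : ∀ r → H (suc r) ≡ (H r + G r) * x + H r * y
    H-suc r = trans (cong F (cong suc (+-comm a (r * a)))) (F[m+1+n] (suc (r * a)) c)

    -- With A the Fibonacci matrix, A^a = x A + y I; the binomial expansion of (x A + y I)^r gives these.
    yG∧yH[mod⁺x²] : ∀ r → y * G r ≡ r * x * y ^ r [mod⁺ x * x ] × y * H r ≡ y * y ^ r + r * x * y ^ r [mod⁺ x * x ]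
    yG∧yH[mod⁺x²] zero = (0 , base₁ y) , (0 , base₂ y)
      where
      base₁ : ∀ y → y * 0 ≡ 0 * x * 1 + 0 * (x * x)
      base₁ = solve-∀
      base₂ : ∀ y → y * 1 ≡ y * 1 + 0 * x * 1 + 0 * (x * x)
      base₂ = solve-∀
    yG∧yH[mod⁺x²] (suc r) with yG∧yH[mod⁺x²] r
    ... | (t₁ , eG) , (t₂ , eH) =
      (r * w + t₂ * x + t₁ * y , trans (cong (y *_) (G-suc r)) (trans (expandG x y (H r) (G r)) (trans (cong₂ (λ u v → x * u + y * v) eH eG) (collectG x y w r t₁ t₂)))) ,
      (2 * r * w + t₂ * x + t₁ * x + t₂ * y , trans (cong (y *_) (H-suc r)) (trans (expandH x y (H r) (G r)) (trans (cong₂ (λ u v → x * u + x * v + y * u) eH eG) (collectH x y w r t₁ t₂))))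
      where
      w : ℕ
      w = y ^ r
      expandG : ∀ x y H G → y * (H * x + G * y) ≡ x * (y * H) + y * (y * G)
      expandG = solve-∀
      collectG : ∀ x y w r t₁ t₂ → x * (y * w + r * x * w + t₂ * (x * x)) + y * (r * x * w + t₁ * (x * x)) ≡ suc r * x * (y * w) + (r * w + t₂ * x + t₁ * y) * (x * x)
      collectG = solve-∀
      expandH : ∀ x y H G → y * ((H + G) * x + H * y) ≡ x * (y * H) + x * (y * G) + y * (y * H)
      expandH = solve-∀
      collectH : ∀ x y w r t₁ t₂ → x * (y * w + r * x * w + t₂ * (x * x)) + x * (r * x * w + t₁ * (x * x)) + y * (y * w + r * x * w + t₂ * (x * x))
         ≡ y * (y * w) + suc r * x * (y * w) + (2 * r * w + t₂ * x + t₁ * x + t₂ * y) * (x * x)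
      collectH = solve-∀

    y²H[mod⁺x³] : ∀ r → y * y * H r ≡ y * y * y ^ r + r * x * y * y ^ r + twiceChoose2 r * (x * x) * y ^ r [mod⁺ x * x * x ]
    y²H[mod⁺x³] zero = 0 , base y
      where
      base : ∀ y → y * y * 1 ≡ y * y * 1 + 0 * x * y * 1 + 0 * (x * x) * 1 + 0 * (x * x * x)
      base = solve-∀
    y²H[mod⁺x³] (suc r) with proj₁ (yG∧yH[mod⁺x²] r) | y²H[mod⁺x³] r
    ... | (t₁ , eG) | (t₃ , eH) =
      twiceChoose2 r * w + t₃ * x + t₁ * y + t₃ * y ,
      trans (cong (y * y *_) (H-suc r)) (trans (expand x y (H r) (G r)) (trans (cong₂ (λ u v → x * u + x * y * v + y * u) eH eG) (collect x y w r (twiceChoose2 r) t₁ t₃)))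
      where
      w : ℕ
      w = y ^ r
      expand : ∀ x y H G → y * y * ((H + G) * x + H * y) ≡ x * (y * y * H) + x * y * (y * G) + y * (y * y * H)
      expand = solve-∀
      collect : ∀ x y w r p t₁ t₃ → x * (y * y * w + r * x * y * w + p * (x * x) * w + t₃ * (x * x * x)) + x * y * (r * x * w + t₁ * (x * x)) + y * (y * y * w + r * x * y * w + p * (x * x) * w + t₃ * (x * x * x))
        ≡ y * y * (y * w) + suc r * x * y * (y * w) + (p + 2 * r) * (x * x) * (y * w) + (p * w + t₃ * x + t₁ * y + t₃ * y) * (x * x * x)
      collect = solve-∀

    2y²G[mod⁺x³] : ∀ r → 2 * (y * y * G r) ≡ 2 * r * x * y * y ^ r + twiceChoose2 r * (x * x) * y ^ r [mod⁺ x * x * x ]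
    2y²G[mod⁺x³] zero = 0 , base y
      where
      base : ∀ y → 2 * (y * y * 0) ≡ 2 * 0 * x * y * 1 + 0 * (x * x) * 1 + 0 * (x * x * x)
      base = solve-∀
    2y²G[mod⁺x³] (suc r) with y²H[mod⁺x³] r | 2y²G[mod⁺x³] r
    ... | (t₃ , eH) | (t₄ , eG) =
      2 * twiceChoose2 r * w + 2 * t₃ * x + t₄ * y ,
      trans (cong (λ u → 2 * (y * y * u)) (G-suc r)) (trans (expand x y (H r) (G r)) (trans (cong₂ (λ u v → 2 * x * u + y * v) eH eG) (collect x y w r (twiceChoose2 r) t₃ t₄)))
      where
      w : ℕ
      w = y ^ r
      expand : ∀ x y H G → 2 * (y * y * (H * x + G * y)) ≡ 2 * x * (y * y * H) + y * (2 * (y * y * G))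
      expand = solve-∀
      collect : ∀ x y w r p t₃ t₄ → 2 * x * (y * y * w + r * x * y * w + p * (x * x) * w + t₃ * (x * x * x)) + y * (2 * r * x * y * w + p * (x * x) * w + t₄ * (x * x * x))
        ≡ 2 * suc r * x * y * (y * w) + (p + 2 * r) * (x * x) * (y * w) + (2 * p * w + 2 * t₃ * x + t₄ * y) * (x * x * x)
      collect = solve-∀

    instance
      x≢0 : NonZero x
      x≢0 = >-nonZero (0<F[1+n] c)

  module _ (q Q : ℕ) (F[q*a]≡Q*x : F (q * a) ≡ Q * x) where

    yQ≡qyᵠ[mod⁺x] : y * Q ≡ q * y ^ q [mod⁺ x ]
    yQ≡qyᵠ[mod⁺x] with proj₁ (yG∧yH[mod⁺x²] q)
    ... | t , e = t , *-cancelʳ-≡ (y * Q) (q * y ^ q + t * x) x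
         (trans (*-assoc y Q x) (trans (cong (y *_) (sym F[q*a]≡Q*x)) (trans e (factor x y (y ^ q) q t))))
      where
      factor : ∀ x y w q t → q * x * w + t * (x * x) ≡ (q * w + t * x) * x
      factor = solve-∀

    2y²Q[mod⁺x²] : 2 * (y * y * Q) ≡ 2 * q * y * y ^ q + twiceChoose2 q * x * y ^ q [mod⁺ x * x ]
    2y²Q[mod⁺x²] with 2y²G[mod⁺x³] q
    ... | t , e = t , *-cancelʳ-≡ _ _ x
         (trans (reassoc y Q x) (trans (cong (λ u → 2 * (y * y * u)) (sym F[q*a]≡Q*x)) (trans e (factor x y (y ^ q) q (twiceChoose2 q) t))))
      where
      reassoc : ∀ y Q x → 2 * (y * y * Q) * x ≡ 2 * (y * y * (Q * x))
      reassoc = solve-∀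
      factor : ∀ x y w q p t → 2 * q * x * y * w + p * (x * x) * w + t * (x * x * x) ≡ (2 * q * y * w + p * x * w + t * (x * x)) * x
      factor = solve-∀

prime∤1 : ∀ {p} → Prime p → ¬ p ∣ 1
prime∤1 (prime _) p∣1 with ∣1⇒≡1 p∣1
prime∤1 (prime {{()}} _) _ | refl

prime∣prime⇒≡ : ∀ {p q} → Prime p → Prime q → p ∣ q → p ≡ q
prime∣prime⇒≡ p-prime q-prime p∣q with prime⇒irreducible q-prime p∣q
... | inj₁ refl = contradiction ∣-refl (prime∤1 p-prime)
... | inj₂ p≡q = p≡q

prime∣^⇒∣ : ∀ {p y} r → Prime p → p ∣ y ^ r → p ∣ y
prime∣^⇒∣ zero p-prime p∣1 = contradiction p∣1 (prime∤1 p-prime)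
prime∣^⇒∣ {y = y} (suc r) p-prime p∣y^[1+r] with euclidsLemma y (y ^ r) p-prime p∣y^[1+r]
... | inj₁ p∣y = p∣y
... | inj₂ p∣y^r = prime∣^⇒∣ r p-prime p∣y^r

∃primeFactor : ∀ d → 1 < d → ∃[ p ] Prime p × p ∣ d
∃primeFactor (suc zero) (s≤s ())
∃primeFactor d@(suc (suc _)) _ with factorise d
... | record { factors = p ∷ ps ; isFactorisation = d≡p*ps ; factorsPrime = p-prime ∷ _ } =
  p , p-prime , subst (p ∣_) (sym d≡p*ps) (m∣m*n (product ps))

noCommonPrime⇒coprime : ∀ {m n} → 0 < n → (∀ {p} → Prime p → p ∣ m → ¬ p ∣ n) → Coprime m n
noCommonPrime⇒coprime {n = n} 0<n noCommon {d} (d∣m , d∣n) with d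
... | zero = contradiction (0∣⇒≡0 d∣n) (≢-nonZero⁻¹ n {{>-nonZero 0<n}})
... | suc zero = refl
... | suc (suc _) with ∃primeFactor _ (s≤s (s≤s z≤n))
...   | p , p-prime , p∣d = contradiction (∣-trans p∣d d∣n) (noCommon p-prime (∣-trans p∣d d∣m))

prime∣F[1+n]⇒∤F[n] : ∀ {p} n → Prime p → p ∣ F (suc n) → ¬ p ∣ F n
prime∣F[1+n]⇒∤F[n] n p-prime p∣F[1+n] p∣F[n] = prime∤1 p-prime (∣F[n]∧∣F[1+n]⇒∣1 n p∣F[n] p∣F[1+n])

entryPoint[2] : IsEntryPoint 2 3
entryPoint[2] = s≤s z≤n , divides 1 refl , λ where
  1 _ _ 2∣1 → contradiction (∣1⇒≡1 2∣1) (λ ())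
  2 _ _ 2∣1 → contradiction (∣1⇒≡1 2∣1) (λ ())
  (suc (suc (suc _))) _ (s≤s (s≤s (s≤s ())))

entryPoint[3] : IsEntryPoint 3 4
entryPoint[3] = s≤s z≤n , divides 1 refl , λ where
  1 _ _ 3∣1 → contradiction (∣1⇒≡1 3∣1) (λ ())
  2 _ _ 3∣1 → contradiction (∣1⇒≡1 3∣1) (λ ())
  3 _ _ 3∣2 → contradiction (∣⇒≤ 3∣2) (λ { (s≤s (s≤s ())) })
  (suc (suc (suc (suc _)))) _ (s≤s (s≤s (s≤s (s≤s ()))))

module _ (c q Q : ℕ) (F[q*a]≡Q*x : F (q * suc c) ≡ Q * F (suc c)) where
  private
    x y : ℕ
    x = F (suc c)
    y = F c

  ∣F[a]∧∣quotient⇒∣q : ∀ {p} → Prime p → p ∣ x → p ∣ Q → p ∣ q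
  ∣F[a]∧∣quotient⇒∣q {p} p-prime p∣x p∣Q with yQ≡qyᵠ[mod⁺x] c q Q F[q*a]≡Q*x
  ... | t , yQ≡qyᵠ+tx with euclidsLemma q (y ^ q) p-prime p∣qyᵠ
    where
    p∣qyᵠ : p ∣ q * y ^ q
    p∣qyᵠ = ∣m+n∣m⇒∣n (subst (p ∣_) (trans yQ≡qyᵠ+tx (+-comm (q * y ^ q) (t * x))) (∣n⇒∣m*n y p∣Q)) (∣n⇒∣m*n t p∣x)
  ... | inj₁ p∣q = p∣q
  ... | inj₂ p∣yᵠ = contradiction (prime∣^⇒∣ q p-prime p∣yᵠ) (prime∣F[1+n]⇒∤F[n] c p-prime p∣x)

  oddPrime-exactlyDivides-quotient : Prime q → q ≢ 2 → q ∣ x → ∃[ W ] Q ≡ q * W × ¬ q ∣ W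
  oddPrime-exactlyDivides-quotient q-prime q≢2 q∣x with yQ≡qyᵠ[mod⁺x] c q Q F[q*a]≡Q*x
  ... | t , yQ≡qyᵠ+tx with euclidsLemma y Q q-prime q∣yQ
    where
    q∣yQ : q ∣ y * Q
    q∣yQ = subst (q ∣_) (sym yQ≡qyᵠ+tx) (∣m∣n⇒∣m+n (m∣m*n (y ^ q)) (∣n⇒∣m*n t q∣x))
  ... | inj₁ q∣y = contradiction q∣y (prime∣F[1+n]⇒∤F[n] c q-prime q∣x)
  ... | inj₂ (divides W Q≡W*q) = W , trans Q≡W*q (*-comm W q) , q∤W
    where
    instance
      q≢0 : NonZero q
      q≢0 = prime⇒nonZero q-prime
    -- q ∣ x and q ∣ twiceChoose2 q, so modulo q² only 2 q y y^q survives on the right of 2y²Q[mod⁺x²]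
    q∤W : ¬ q ∣ W
    q∤W q∣W with 2y²Q[mod⁺x²] c q Q F[q*a]≡Q*x
    ... | t₂ , e = q∤2yyᵠ (*-cancelˡ-∣ q (subst (q * q ∣_) (pullOut q y (y ^ q)) q²∣A))
      where
      A B C : ℕ
      A = 2 * q * y * y ^ q
      B = twiceChoose2 q * x * y ^ q
      C = t₂ * (x * x)
      q²∣Q : q * q ∣ Q
      q²∣Q = subst (q * q ∣_) (sym Q≡W*q) (*-pres-∣ q∣W ∣-refl)
      q²∣A+B+C : q * q ∣ A + B + C
      q²∣A+B+C = subst (q * q ∣_) e (∣n⇒∣m*n 2 (∣n⇒∣m*n (y * y) q²∣Q))
      q²∣A+B : q * q ∣ A + B
      q²∣A+B = ∣m+n∣m⇒∣n (subst (q * q ∣_) (+-comm (A + B) C) q²∣A+B+C) (∣n⇒∣m*n t₂ (*-pres-∣ q∣x q∣x))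
      q²∣A : q * q ∣ A
      q²∣A = ∣m+n∣m⇒∣n (subst (q * q ∣_) (+-comm A B) q²∣A+B) (∣m⇒∣m*n (y ^ q) (*-pres-∣ (q∣twiceChoose2[q] q) q∣x))
      pullOut : ∀ q y w → 2 * q * y * w ≡ q * (2 * y * w)
      pullOut = solve-∀
      q∤2yyᵠ : ¬ q ∣ 2 * y * y ^ q
      q∤2yyᵠ q∣2yyᵠ with euclidsLemma (2 * y) (y ^ q) q-prime q∣2yyᵠ
      ... | inj₂ q∣yᵠ = prime∣F[1+n]⇒∤F[n] c q-prime q∣x (prime∣^⇒∣ q q-prime q∣yᵠ)
      ... | inj₁ q∣2y with euclidsLemma 2 y q-prime q∣2y
      ...   | inj₁ q∣2 = q≢2 (prime∣prime⇒≡ q-prime prime[2] q∣2)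
      ...   | inj₂ q∣y = prime∣F[1+n]⇒∤F[n] c q-prime q∣x q∣y

2∤3 : ¬ 2 ∣ 3
2∤3 2∣3 = contradiction (∣1⇒≡1 (∣m+n∣m⇒∣n {m = 2} 2∣3 ∣-refl)) (λ ())

-- 2 ∣ F a forces 3 ∣ a, hence 6 ∣ a and 8 = F 6 ∣ F a, so F (2a) / F a = F a + 2 F (a − 1) is 2 · odd
two-exactlyDivides-quotient : ∀ c → 2 ∣ suc c → 2 ∣ F (suc c) → ∃[ W ] F (2 * suc c) ≡ 2 * W * F (suc c) × ¬ 2 ∣ W
two-exactlyDivides-quotient c 2∣a 2∣x with F-mono-∣ {6} {suc c} 6∣a
  where
  6∣a : 6 ∣ suc c
  6∣a with entryPoint∣ entryPoint[2] 2∣x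
  ... | divides u a≡u*3 with euclidsLemma u 3 prime[2] (subst (2 ∣_) a≡u*3 2∣a)
  ...   | inj₁ (divides v u≡v*2) = divides v (trans a≡u*3 (trans (cong (_* 3) u≡v*2) (*-assoc v 2 3)))
  ...   | inj₂ 2∣3 = contradiction 2∣3 2∤3
... | divides u x≡u*8 = u * 4 + y , trans (F[2*a] c) (cong (_* F (suc c)) (trans (cong (_+ 2 * y) x≡u*8) (regroup u y))) , 2∤W
  where
  y : ℕ
  y = F c
  regroup : ∀ u y → u * 8 + 2 * y ≡ 2 * (u * 4 + y)
  regroup = solve-∀
  2∤W : ¬ 2 ∣ u * 4 + y
  2∤W 2∣W = prime∣F[1+n]⇒∤F[n] c prime[2] 2∣x (∣m+n∣m⇒∣n 2∣W (∣n⇒∣m*n u (divides 2 refl)))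

prime-exactlyDivides-quotient : ∀ {q} a .{{_ : NonZero a}} → Prime q → q ∣ F a → (q ≡ 2 → 2 ∣ a) →
  ∃[ W ] F (q * a) ≡ q * W * F a × ¬ q ∣ W
prime-exactlyDivides-quotient {q} (suc c) q-prime q∣x q≡2⇒2∣a with q ≟ 2 | F[a]∣F[j*a] (suc c) q
... | yes refl | _ = two-exactlyDivides-quotient c (q≡2⇒2∣a refl) q∣x
... | no q≢2 | divides Q F[qa]≡Qx with oddPrime-exactlyDivides-quotient c q Q F[qa]≡Qx q-prime q≢2 q∣x
...   | W , Q≡qW , q∤W = W , trans F[qa]≡Qx (cong (_* F (suc c)) Q≡qW) , q∤W

-- the hypotheses on X under which X r ∣ F (r a) descends to X ∣ F a
Admissible : ℕ → ℕ → Set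
Admissible a X = (∀ {p} → Prime p → p ∣ X → p ∣ F a) × (2 ∣ X → 2 ∣ a)

module _ {c X q : ℕ} (adm : Admissible (suc c) X) (q-prime : Prime q) where
  private
    a : ℕ
    a = suc c
    instance
      q≢0 : NonZero q
      q≢0 = prime⇒nonZero q-prime

  commonPrime[X,quotient]≡q : ∀ {Q p} → F (q * a) ≡ Q * F a → Prime p → p ∣ X → p ∣ Q → p ≡ q
  commonPrime[X,quotient]≡q {Q} F[qa]≡Qx p-prime p∣X p∣Q = prime∣prime⇒≡ p-prime q-prime (∣F[a]∧∣quotient⇒∣q c q Q F[qa]≡Qx p-prime (proj₁ adm p-prime p∣X) p∣Q)

  0<cofactor : ∀ d {W} → F (q * a) ≡ d * W * F a → 0 < W
  0<cofactor d {zero} F[qa]≡0 = contradiction (trans F[qa]≡0 (cong (_* F a) (*-zeroʳ d))) (n>0⇒n≢0 (0<F[q*a] q))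
    where
    0<F[q*a] : ∀ q .{{_ : NonZero q}} → 0 < F (q * a)
    0<F[q*a] (suc q) = 0<F[1+n] (c + q * a)
  0<cofactor d {suc W} _ = s≤s z≤n

  splitQuotient : ∃₂ λ d W → d ∣ q × d ∣ F a × F (q * a) ≡ d * W * F a × Coprime X W
  splitQuotient with q ∣? X | F[a]∣F[j*a] a q
  ... | no q∤X | divides Q F[qa]≡Qx = 1 , Q , 1∣ q , 1∣ F a , F[qa]≡1Qx ,
    noCommonPrime⇒coprime (0<cofactor 1 F[qa]≡1Qx)
      λ p-prime p∣X p∣Q → q∤X (subst (_∣ X) (commonPrime[X,quotient]≡q F[qa]≡Qx p-prime p∣X p∣Q) p∣X)
    where
    F[qa]≡1Qx : F (q * a) ≡ 1 * Q * F a
    F[qa]≡1Qx = trans F[qa]≡Qx (cong (_* F a) (sym (*-identityˡ Q)))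
  ... | yes q∣X | _ with prime-exactlyDivides-quotient a q-prime (proj₁ adm q-prime q∣X) (λ { refl → proj₂ adm q∣X })
  ... | W , F[qa]≡qWx , q∤W = q , W , ∣-refl , proj₁ adm q-prime q∣X , F[qa]≡qWx ,
    noCommonPrime⇒coprime (0<cofactor q F[qa]≡qWx)
      λ p-prime p∣X p∣W → q∤W (subst (_∣ W) (commonPrime[X,quotient]≡q F[qa]≡qWx p-prime p∣X (∣n⇒∣m*n q p∣W)) p∣W)

descentAlong : ∀ qs → All Prime qs → ∀ c X → Admissible (suc c) X →
  X * product qs ∣ F (product qs * suc c) → X ∣ F (suc c)
descentAlong [] [] c X _ X*1∣F[1*a] = subst₂ _∣_ (*-identityʳ X) (cong F (+-identityʳ (suc c))) X*1∣F[1*a]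
descentAlong (zero ∷ _) (0-prime ∷ _) _ _ _ _ = contradiction refl (≢-nonZero⁻¹ 0 {{prime⇒nonZero 0-prime}})
descentAlong (q@(suc q′) ∷ qs) (q-prime ∷ qs-prime) c X (X⇒F[a] , 2∣X⇒2∣a) X*qR∣F[qR*a]
  with splitQuotient (X⇒F[a] , 2∣X⇒2∣a) q-prime
... | d , W , d∣q , d∣x , F[qa]≡dWx , coprime[X,W] = coprime-divisor coprime[X,W] X∣W*x
  where
  R a : ℕ
  R = product qs
  a = suc c
  instance
    d≢0 : NonZero d
    d≢0 = ≢-nonZero λ { refl → contradiction (0∣⇒≡0 d∣q) λ () }
  admissible[qa] : Admissible (q * a) (X * d)
  admissible[qa] = primes , two
    where
    primes : ∀ {p} → Prime p → p ∣ X * d → p ∣ F (q * a)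
    primes p-prime p∣Xd with euclidsLemma X d p-prime p∣Xd
    ... | inj₁ p∣X = ∣-trans (X⇒F[a] p-prime p∣X) (F-mono-∣ {a} (n∣m*n q))
    ... | inj₂ p∣d = ∣-trans (∣-trans p∣d d∣x) (F-mono-∣ {a} (n∣m*n q))
    two : 2 ∣ X * d → 2 ∣ q * a
    two 2∣Xd with euclidsLemma X d prime[2] 2∣Xd
    ... | inj₁ 2∣X = ∣n⇒∣m*n q (2∣X⇒2∣a 2∣X)
    ... | inj₂ 2∣d = ∣m⇒∣m*n a (∣-trans 2∣d d∣q)
  X*d*R∣F[R*qa] : X * d * R ∣ F (R * (q * a))
  X*d*R∣F[R*qa] = subst₂ _∣_ (sym (*-assoc X d R)) (cong F (reassoc q R a))
    (∣-trans (*-monoʳ-∣ X (*-monoˡ-∣ R d∣q)) X*qR∣F[qR*a])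
    where
    reassoc : ∀ q R a → q * R * a ≡ R * (q * a)
    reassoc = solve-∀
  X∣W*x : X ∣ W * F a
  X∣W*x = *-cancelˡ-∣ d (subst₂ _∣_ (*-comm X d) (trans F[qa]≡dWx (*-assoc d W (F a)))
    (descentAlong qs qs-prime (c + q′ * a) (X * d) admissible[qa] X*d*R∣F[R*qa]))

descent : ∀ r a X → .{{_ : NonZero r}} → .{{_ : NonZero a}} → Admissible a X → X * r ∣ F (r * a) → X ∣ F a
descent r (suc c) X adm X*r∣F[ra] with factorise r
... | record { factors = qs ; isFactorisation = r≡Πqs ; factorsPrime = qs-prime } =
  descentAlong qs qs-prime c X adm (subst (λ r → X * r ∣ F (r * suc c)) r≡Πqs X*r∣F[ra])

lcmUpTo : (ℕ → ℕ) → ℕ → ℕ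
lcmUpTo f zero = 1
lcmUpTo f (suc j) = lcm (lcmUpTo f j) (f (suc j))

f∣lcmUpTo : ∀ f {i j} → i < j → f (suc i) ∣ lcmUpTo f j
f∣lcmUpTo f {i} {suc j} i<1+j with m≤n⇒m<n∨m≡n (s≤s⁻¹ i<1+j)
... | inj₁ i<j = ∣-trans (f∣lcmUpTo f i<j) (m∣lcm[m,n] (lcmUpTo f j) (f (suc j)))
... | inj₂ refl = n∣lcm[m,n] (lcmUpTo f j) (f (suc j))

lcmUpTo-least : ∀ f j {M} → (∀ i → i < j → f (suc i) ∣ M) → lcmUpTo f j ∣ M
lcmUpTo-least f zero {M} _ = 1∣ M
lcmUpTo-least f (suc j) f∣M = lcm-least (lcmUpTo-least f j λ i i<j → f∣M i (m<n⇒m<1+n i<j)) (f∣M j ≤-refl)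

0<n∧d∣n⇒0<d : ∀ {d n} → 0 < n → d ∣ n → 0 < d
0<n∧d∣n⇒0<d {zero} 0<n 0∣n = contradiction (0∣⇒≡0 0∣n) (n>0⇒n≢0 0<n)
0<n∧d∣n⇒0<d {suc d} _ _ = s≤s z≤n

module _ (f : ℕ → ℕ) {m} (0<m : 0 < m) (f∣m : ∀ i → f (suc i) ∣ m) where

  lcmUpTo∣m : ∀ j → lcmUpTo f j ∣ m
  lcmUpTo∣m j = lcmUpTo-least f j λ i _ → f∣m i

  -- until it stalls, lcmUpTo f j strictly increases in j, but it never exceeds m
  private
    grows : ∀ j → (∃[ i ] f (suc i) ∣ lcmUpTo f i) ⊎ j < lcmUpTo f j
    grows zero = inj₂ (s≤s z≤n)
    grows (suc j) with grows j | f (suc j) ∣? lcmUpTo f j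
    ... | inj₁ stall | _ = inj₁ stall
    ... | inj₂ _ | yes f∣L = inj₁ (j , f∣L)
    ... | inj₂ j<L | no f∤L = inj₂ (<-≤-trans (s≤s j<L) (≤∧≢⇒< L≤L′ L≢L′))
      where
      L L′ : ℕ
      L = lcmUpTo f j
      L′ = lcmUpTo f (suc j)
      L≤L′ : L ≤ L′
      L≤L′ = ∣⇒≤ {{>-nonZero (0<n∧d∣n⇒0<d 0<m (lcmUpTo∣m (suc j)))}} (m∣lcm[m,n] L (f (suc j)))
      L≢L′ : L ≢ L′
      L≢L′ L≡L′ = f∤L (subst (f (suc j) ∣_) (sym L≡L′) (n∣lcm[m,n] L (f (suc j))))

  lcmUpTo-stalls : ∃[ j ] f (suc j) ∣ lcmUpTo f j
  lcmUpTo-stalls with grows m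
  ... | inj₁ stall = stall
  ... | inj₂ m<L = contradiction (∣⇒≤ {{>-nonZero 0<m}} (lcmUpTo∣m m)) (<⇒≱ m<L)

module EntryPointFunction (z : ℕ → ℕ) (isEntryPoint : ∀ n → 0 < n → IsEntryPoint n (z n)) where

  0<z : ∀ {n} → 0 < n → 0 < z n
  0<z {n} 0<n = proj₁ (isEntryPoint n 0<n)

  ∣F[z] : ∀ {n} → 0 < n → n ∣ F (z n)
  ∣F[z] {n} 0<n = proj₁ (proj₂ (isEntryPoint n 0<n))

  z∣ : ∀ {n m} → 0 < n → n ∣ F m → z n ∣ m
  z∣ {n} 0<n = entryPoint∣ (isEntryPoint n 0<n)

  z-mono-∣ : ∀ {a b} → 0 < b → a ∣ b → z a ∣ z b
  z-mono-∣ {a} 0<b a∣b = z∣ (0<n∧d∣n⇒0<d 0<b a∣b) (∣-trans a∣b (∣F[z] 0<b))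

  z∣n⇒z[z]∣z : ∀ {n} → 0 < n → z n ∣ n → z (z n) ∣ z n
  z∣n⇒z[z]∣z 0<n zn∣n = z∣ (0<z 0<n) (∣-trans zn∣n (∣F[z] 0<n))

  module _ {k : ℕ} (0<k : 0 < k) where

    zⁱ : ℕ → ℕ
    zⁱ i = iter z i k

    0<zⁱ : ∀ i → 0 < zⁱ i
    0<zⁱ zero = 0<k
    0<zⁱ (suc i) = 0<z (0<zⁱ i)

    zⁱ∣ : ∀ {m} → 0 < m → z k ∣ m → z m ∣ m → ∀ i → zⁱ (suc i) ∣ m
    zⁱ∣ _ zk∣m _ zero = zk∣m
    zⁱ∣ 0<m zk∣m zm∣m (suc i) = ∣-trans (z-mono-∣ 0<m (zⁱ∣ 0<m zk∣m zm∣m i)) zm∣m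

    zⁱ∣z : ∀ {n} → 0 < n → k ∣ n → z n ∣ n → ∀ i → zⁱ (suc i) ∣ z n
    zⁱ∣z 0<n k∣n zn∣n = zⁱ∣ (0<z 0<n) (z-mono-∣ 0<n k∣n) (z∣n⇒z[z]∣z 0<n zn∣n)

    lcm-exists : ∀ {m} → 0 < m → (∀ i → zⁱ (suc i) ∣ m) → ∃[ L ] IsLcmOfSeq zⁱ L
    lcm-exists 0<m zⁱ∣m with lcmUpTo-stalls zⁱ 0<m zⁱ∣m
    ... | j , stall = L , (λ { (suc i) _ → zⁱ∣L i }) , λ M zⁱ∣M → lcmUpTo-least zⁱ j λ i _ → zⁱ∣M (suc i) (s≤s z≤n)
      where
      L : ℕ
      L = lcmUpTo zⁱ j
      0<L : 0 < L
      0<L = 0<n∧d∣n⇒0<d 0<m (lcmUpTo∣m zⁱ 0<m zⁱ∣m j)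
      zⁱ∣L-upTo : ∀ i → i ≤ j → zⁱ (suc i) ∣ L
      zⁱ∣L-upTo i i≤j with m≤n⇒m<n∨m≡n i≤j
      ... | inj₁ i<j = f∣lcmUpTo zⁱ i<j
      ... | inj₂ refl = stall
      L∣F[L] : L ∣ F L
      L∣F[L] = lcmUpTo-least zⁱ j λ i i<j → ∣-trans (∣F[z] (0<zⁱ (suc i))) (F-mono-∣ (zⁱ∣L-upTo (suc i) i<j))
      zⁱ∣L : ∀ i → zⁱ (suc i) ∣ L
      zⁱ∣L = zⁱ∣ 0<L (zⁱ∣L-upTo 0 z≤n) (z∣ 0<L L∣F[L])

    module _ {L : ℕ} (isLcm : IsLcmOfSeq zⁱ L) where

      L∣z : ∀ {n} → 0 < n → k ∣ n → z n ∣ n → L ∣ z n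
      L∣z {n} 0<n k∣n zn∣n = proj₂ isLcm (z n) λ { (suc i) _ → zⁱ∣z 0<n k∣n zn∣n i }

      L∣F[L] : L ∣ F L
      L∣F[L] = proj₂ isLcm (F L) λ { (suc i) _ → ∣-trans (∣F[z] (0<zⁱ (suc i))) (F-mono-∣ (proj₁ isLcm (suc (suc i)) (s≤s z≤n))) }

      -- z 2 = 3 and z 3 = 4, so an even k forces 4 ∣ z (z k) ∣ L
      k*L-admissible : Admissible L (k * L)
      k*L-admissible = primes , two
        where
        zk∣L : z k ∣ L
        zk∣L = proj₁ isLcm 1 (s≤s z≤n)
        primes : ∀ {p} → Prime p → p ∣ k * L → p ∣ F L
        primes p-prime p∣kL with euclidsLemma k L p-prime p∣kL
        ... | inj₁ p∣k = ∣-trans p∣k (∣-trans (∣F[z] 0<k) (F-mono-∣ zk∣L))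
        ... | inj₂ p∣L = ∣-trans p∣L L∣F[L]
        two : 2 ∣ k * L → 2 ∣ L
        two 2∣kL with euclidsLemma k L prime[2] 2∣kL
        ... | inj₂ 2∣L = 2∣L
        ... | inj₁ 2∣k = ∣-trans (divides 2 refl) (∣-trans 4∣z[zk] (proj₁ isLcm 2 (s≤s z≤n)))
          where
          3∣zk : 3 ∣ z k
          3∣zk = entryPoint∣ entryPoint[2] (∣-trans 2∣k (∣F[z] 0<k))
          4∣z[zk] : 4 ∣ z (z k)
          4∣z[zk] = entryPoint∣ entryPoint[3] (∣-trans 3∣zk (∣F[z] (0<z 0<k)))

      k*L∣F[L] : ∀ {m} → 0 < m → k * m ∣ F m → L ∣ m → k * L ∣ F L
      k*L∣F[L] 0<m km∣F[m] (divides r m≡r*L) = descent r L (k * L) k*L-admissible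
        (subst (_∣ F (r * L)) (regroup k r L) (subst (λ t → k * t ∣ F t) m≡r*L km∣F[m]))
        where
        instance
          r≢0 : NonZero r
          r≢0 = ≢-nonZero λ { refl → n>0⇒n≢0 0<m m≡r*L }
          L≢0 : NonZero L
          L≢0 = ≢-nonZero λ { refl → n>0⇒n≢0 0<m (trans m≡r*L (*-zeroʳ r)) }
        regroup : ∀ k r L → k * (r * L) ≡ k * L * r
        regroup = solve-∀

      k*L-minimal : ∀ {m} → 0 < m → k * m ∣ F m → L ∣ m → IsMin (InA z k) (k * L)
      k*L-minimal 0<m km∣F[m] L∣m = (0<kL , subst (_∣ k * L) (sym z[kL]≡L) (n∣m*n k) , cong (k *_) (sym z[kL]≡L)) , least
        where
        0<kL : 0 < k * L
        0<kL = >-nonZero⁻¹ (k * L) {{m*n≢0 k L {{>-nonZero 0<k}} {{>-nonZero (0<n∧d∣n⇒0<d 0<m L∣m)}}}}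
        z[kL]∣L : z (k * L) ∣ L
        z[kL]∣L = z∣ 0<kL (k*L∣F[L] 0<m km∣F[m] L∣m)
        z[kL]≡L : z (k * L) ≡ L
        z[kL]≡L = ∣-antisym z[kL]∣L (L∣z 0<kL (m∣m*n L) (∣-trans z[kL]∣L (n∣m*n k)))
        least : ∀ n → InA z k n → k * L ≤ n
        least n (0<n , zn∣n , n≡k*zn) = subst (k * L ≤_) (sym n≡k*zn)
          (*-monoʳ-≤ k (∣⇒≤ {{>-nonZero (0<z 0<n)}} (L∣z 0<n (subst (k ∣_) (sym n≡k*zn) (m∣m*n (z n))) zn∣n)))

theorem2p2 : (z : ℕ → ℕ) → (∀ n → 0 < n → IsEntryPoint n (z n)) →
    ∀ k → 0 < k → ∃ (λ n → InA z k n) →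
    Σ ℕ (λ L → IsLcmOfSeq (λ i → iter z i k) L × IsMin (InA z k) (k * L))
theorem2p2 z isEntryPoint k 0<k (n₀ , 0<n₀ , zn₀∣n₀ , n₀≡k*zn₀) =
  let L , isLcm = lcm-exists 0<k (0<z 0<n₀) (zⁱ∣z 0<k 0<n₀ k∣n₀ zn₀∣n₀)
  in L , isLcm , k*L-minimal 0<k isLcm (0<z 0<n₀) k*zn₀∣F[zn₀] (L∣z 0<k isLcm 0<n₀ k∣n₀ zn₀∣n₀)
  where
  open EntryPointFunction z isEntryPoint
  k∣n₀ : k ∣ n₀
  k∣n₀ = subst (k ∣_) (sym n₀≡k*zn₀) (m∣m*n (z n₀))
  k*zn₀∣F[zn₀] : k * z n₀ ∣ F (z n₀)
  k*zn₀∣F[zn₀] = subst (_∣ F (z n₀)) n₀≡k*zn₀ (∣F[z] 0<n₀)
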